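{- Let $\mathcal{S}$ be a PTRS. If $\mathcal{S}$ is fAST (resp. iAST) w.r.t. $\to^{\mathrm{sim}}_{\mathcal{S}}$, i.e., every infinite rewrite sequence with the lifting of $\to^{\mathrm{sim}}_{\mathcal{S}}$ (resp. of $\to^{\mathrm{isim}}_{\mathcal{S}}$) converges with probability $1$, then $\mathcal{S}$ is fAST (resp. iAST). Analogously, if $\mathcal{S}$ is fPAST (resp. iPAST) w.r.t. $\to^{\mathrm{sim}}_{\mathcal{S}}$, i.e., every infinite rewrite sequence with the lifting of $\to^{\mathrm{sim}}_{\mathcal{S}}$ (resp. of $\to^{\mathrm{isim}}_{\mathcal{S}}$) has finite expected derivation length, then $\mathcal{S}$ is fPAST (resp. iPAST).
   Context: A PTRS $\mathcal{S}$ is a set of rules $\ell \to \{p_1:r_1,\ldots,p_k:r_k\}$ with finite multi-distributions on right-hand sides. It induces $s \to_{\mathcal{S}} \{p_1:t_1,\ldots,p_k:t_k\}$ if there is a position $\pi$, a rule, and a substitution $\sigma$ with $s|_\pi = \ell\sigma$ and $t_j = s[r_j\sigma]_\pi$; the step is innermost ($\to^{\mathrm{i}}_{\mathcal{S}}$) if all proper subterms of the redex are normal forms. Simultaneous rewriting $s \to^{\mathrm{sim}}_{\mathcal{S}} \{p_1:t_1,\ldots,p_k:t_k\}$ holds if there is a non-empty set $\Pi$ of parallel positions, a rule $\ell \to \{p_1:r_1,\ldots,p_k:r_k\}\in\mathcal{S}$ and a substitution $\sigma$ with $s|_\pi=\ell\sigma$ and $t_j = s[r_j\sigma]_\pi$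 for every $\pi\in\Pi$ (all positions replaced simultaneously) and all $j$; it is innermost simultaneous ($\to^{\mathrm{isim}}_{\mathcal{S}}$) if all proper subterms of $\ell\sigma$ are in normal form. Each relation is lifted to a relation on multi-distributions of terms (normal forms stay, a term is replaced by the distribution it rewrites to, convex combinations are closed). An infinite lifted sequence $(\mu_n)$ converges with probability $\lim_n |\mu_n|_{\mathcal{S}}$, where $|\mu|_{\mathcal{S}}$ is the total probability of normal forms in $\mu$; its expected derivation length is $\sum_{n}(1-|\mu_n|_{\mathcal{S}})$. $\mathcal{S}$ is fAST (iAST) if every infinite sequence with the lifting of $\to_{\mathcal{S}}$ ($\to^{\mathrm{i}}_{\mathcal{S}}$) converges with probability $1$, and fPAST (iPAST) if every such sequence has finite expected derivation length.
   Formalization: The probabilities in the right-hand sides of the rules of $\mathcal{S}$ and in the multi-distributions of the rewrite sequences are rational. -}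

module Defs where

open import Data.Nat using (ℕ; zero; suc; _<_)
open import Data.List using (List; []; _∷_; _++_; map; foldr)
open import Data.List.Relation.Unary.All using (All)
open import Data.List.Relation.Unary.AllPairs using (AllPairs)
open import Data.Vec using (Vec; []; _∷_)
open import Data.Maybe using (Maybe; just; nothing)
open import Data.Product using (Σ; ∃; _×_; _,_; proj₁; proj₂)
open import Data.Rational using (ℚ; 0ℚ; 1ℚ; _+_; _*_; _-_; _≤_)
import Data.Rational as Q
open import Relation.Binary.PropositionalEquality using (_≡_; _≢_)
open import Relation.Nullary using (¬_)

data Term (F : Set) (ar : F → ℕ) (V : Set) : Set where
  var : V → Term F ar V
  fun : (f : F) → Vec (Term F ar V) (ar f) → Term F ar V

-- Positions: lists of (0-based) argument indices
Pos : Set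
Pos = List ℕ

data _≼_ : Pos → Pos → Set where
  ε≼  : ∀ {π} → [] ≼ π
  ∷≼ : ∀ {i π π'} → π ≼ π' → (i ∷ π) ≼ (i ∷ π')

Parallel : Pos → Pos → Set
Parallel π π' = ¬ (π ≼ π') × ¬ (π' ≼ π)

MDist : Set → Set
MDist A = List (ℚ × A)

probSum : ∀ {A : Set} → MDist A → ℚ
probSum [] = 0ℚ
probSum ((p , _) ∷ μ) = p + probSum μ

IsMultiDist : ∀ {A : Set} → MDist A → Set
IsMultiDist μ = All (λ pa → 0ℚ Q.< proj₁ pa) μ × (probSum μ ≡ 1ℚ)

scale : ∀ {A : Set} → ℚ → MDist A → MDist A
scale p = map (λ qa → (p * proj₁ qa , proj₂ qa))

module _ {F : Set} {ar : F → ℕ} {V : Set} where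

  T : Set
  T = Term F ar V

  Subst : Set
  Subst = V → T

  mutual
    _⟨_⟩ : T → Subst → T
    var x ⟨ σ ⟩ = σ x
    fun f ts ⟨ σ ⟩ = fun f (substs ts σ)

    substs : ∀ {n} → Vec T n → Subst → Vec T n
    substs [] σ = []
    substs (t ∷ ts) σ = (t ⟨ σ ⟩) ∷ substs ts σ

  mutual
    _∣_ : T → Pos → Maybe T
    t ∣ [] = just t
    var x ∣ (i ∷ π) = nothing
    fun f ts ∣ (i ∷ π) = argAt ts i π

    argAt : ∀ {n} → Vec T n → ℕ → Pos → Maybe T
    argAt [] i π = nothing
    argAt (t ∷ ts) zero π = t ∣ π
    argAt (t ∷ ts) (suc i) π = argAt ts i π

  -- replacement s[u]_π (identity if the position does not exist)
  mutual
    _[_]at_ : T → T → Pos → T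
    s [ u ]at [] = u
    var x [ u ]at (i ∷ π) = var x
    fun f ts [ u ]at (i ∷ π) = fun f (replArg ts i π u)

    replArg : ∀ {n} → Vec T n → ℕ → Pos → T → Vec T n
    replArg [] i π u = []
    replArg (t ∷ ts) zero π u = (t [ u ]at π) ∷ ts
    replArg (t ∷ ts) (suc i) π u = t ∷ replArg ts i π u

  -- simultaneous replacement at a list of (parallel) positions
  _[_]atAll_ : T → T → List Pos → T
  s [ u ]atAll Π = foldr (λ π s' → s' [ u ]at π) s Π

  record Rule : Set where
    constructor _⇒_
    field
      lhs : T
      rhs : MDist T
  open Rule public

  record PTRS : Set₁ where
    field
      rules : Rule → Set
      rhs-dist : ∀ ρ → rules ρ → IsMultiDist (rhs ρ)
  open PTRS public

  plug : (T → T) → MDist T → MDist T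
  plug c = map (λ pr → (proj₁ pr , c (proj₂ pr)))

  module _ (S : PTRS) where

    Reducible : T → Set
    Reducible s = Σ Rule λ ρ → rules S ρ × Σ Pos λ π → Σ Subst λ σ →
                  s ∣ π ≡ just (lhs ρ ⟨ σ ⟩)

    NF : T → Set
    NF s = ¬ Reducible s

    ProperSubtermsNF : T → Set
    ProperSubtermsNF t = ∀ π u → π ≢ [] → t ∣ π ≡ just u → NF u

    data Step (s : T) : MDist T → Set where
      step : ∀ ρ → rules S ρ → (π : Pos) (σ : Subst) →
             s ∣ π ≡ just (lhs ρ ⟨ σ ⟩) →
             Step s (plug (λ r → s [ r ⟨ σ ⟩ ]at π) (rhs ρ))

    data IStep (s : T) : MDist T → Set where
      istep : ∀ ρ → rules S ρ → (π : Pos) (σ : Subst) →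
              s ∣ π ≡ just (lhs ρ ⟨ σ ⟩) →
              ProperSubtermsNF (lhs ρ ⟨ σ ⟩) →
              IStep s (plug (λ r → s [ r ⟨ σ ⟩ ]at π) (rhs ρ))

    -- s →^sim_S μ : Π non-empty list of pairwise parallel positions
    data SimStep (s : T) : MDist T → Set where
      simstep : ∀ ρ → rules S ρ → (π₀ : Pos) (Π' : List Pos) (σ : Subst) →
                AllPairs Parallel (π₀ ∷ Π') →
                All (λ π → s ∣ π ≡ just (lhs ρ ⟨ σ ⟩)) (π₀ ∷ Π') →
                SimStep s (plug (λ r → s [ r ⟨ σ ⟩ ]atAll (π₀ ∷ Π')) (rhs ρ))

    data ISimStep (s : T) : MDist T → Set where
      isimstep : ∀ ρ → rules S ρ → (π₀ : Pos) (Π' : List Pos) (σ : Subst) →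
                 AllPairs Parallel (π₀ ∷ Π') →
                 All (λ π → s ∣ π ≡ just (lhs ρ ⟨ σ ⟩)) (π₀ ∷ Π') →
                 ProperSubtermsNF (lhs ρ ⟨ σ ⟩) →
                 ISimStep s (plug (λ r → s [ r ⟨ σ ⟩ ]atAll (π₀ ∷ Π')) (rhs ρ))

    data Lift (R : T → MDist T → Set) : MDist T → MDist T → Set where
      lift-[] : Lift R [] []
      lift-nf : ∀ {p t μ ν} → NF t → Lift R μ ν →
                Lift R ((p , t) ∷ μ) ((p , t) ∷ ν)
      lift-step : ∀ {p t ρ μ ν} → R t ρ → Lift R μ ν →
                  Lift R ((p , t) ∷ μ) (scale p ρ ++ ν)

    data NFMass : MDist T → ℚ → Set where
      mass-[] : NFMass [] 0ℚ
      mass-nf : ∀ {p t μ q} → NF t → NFMass μ q → NFMass ((p , t) ∷ μ) (p + q)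
      mass-red : ∀ {p t μ q} → ¬ NF t → NFMass μ q → NFMass ((p , t) ∷ μ) q

    IsRewSeq : (T → MDist T → Set) → (ℕ → MDist T) → Set
    IsRewSeq R μ = IsMultiDist (μ 0) × (∀ n → Lift R (μ n) (μ (suc n)))

    -- lim_n |μ_n|_S = 1  (|μ_n|_S is non-decreasing and bounded by 1)
    ConvergesWithProb1 : (ℕ → MDist T) → Set
    ConvergesWithProb1 μ = ∀ (ε : ℚ) → 0ℚ Q.< ε →
      Σ ℕ λ n → Σ ℚ λ q → NFMass (μ n) q × ((1ℚ - ε) ≤ q)

    partialEDL : (ℕ → ℚ) → ℕ → ℚ
    partialEDL f zero = 0ℚ
    partialEDL f (suc N) = partialEDL f N + (1ℚ - f N)

    -- Σ_n (1 - |μ_n|_S) < ∞  (partial sums of a non-negative series bounded)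
    FiniteEDL : (ℕ → MDist T) → Set
    FiniteEDL μ = Σ ℚ λ C → ∀ (N : ℕ) →
      Σ (ℕ → ℚ) λ f → (∀ n → n < N → NFMass (μ n) (f n)) × (partialEDL f N ≤ C)

    AST-wrt : (T → MDist T → Set) → Set
    AST-wrt R = ∀ μ → IsRewSeq R μ → ConvergesWithProb1 μ

    PAST-wrt : (T → MDist T → Set) → Set
    PAST-wrt R = ∀ μ → IsRewSeq R μ → FiniteEDL μ

    fAST iAST fPAST iPAST : Set
    fAST = AST-wrt Step
    iAST = AST-wrt IStep
    fPAST = PAST-wrt Step
    iPAST = PAST-wrt IStep

    fAST-sim iAST-sim fPAST-sim iPAST-sim : Set
    fAST-sim = AST-wrt SimStep
    iAST-sim = AST-wrt ISimStep
    fPAST-sim = PAST-wrt SimStep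
    iPAST-sim = PAST-wrt ISimStep

{-# OPTIONS --safe #-}
module Submission where

-- A single rewrite step at position π is the simultaneous step with Π = {π}, so every
-- (innermost) rewrite sequence is also an (innermost) simultaneous one; AST and PAST are
-- properties of all sequences and therefore pass from the larger relation to the smaller.

open import Defs
open import Data.Nat using (ℕ)
open import Data.Product using (_×_; _,_)
open import Data.List using ([])
open import Data.List.Relation.Unary.All using ([]; _∷_)
open import Data.List.Relation.Unary.AllPairs using ([]; _∷_)
open import Relation.Binary.Core using () renaming (_⇒_ to _⊆ᴿ_)

module _ {F : Set} {ar : F → ℕ} {V : Set} (S : PTRS {F} {ar} {V}) where

  Step⊆SimStep : Step S ⊆ᴿ SimStep S
  Step⊆SimStep (step ρ ρ∈S π σ match) =
    simstep ρ ρ∈S π [] σ ([] ∷ []) (match ∷ [])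

  IStep⊆ISimStep : IStep S ⊆ᴿ ISimStep S
  IStep⊆ISimStep (istep ρ ρ∈S π σ match innermost) =
    isimstep ρ ρ∈S π [] σ ([] ∷ []) (match ∷ []) innermost

  Lift-mono : ∀ {R R'} → R ⊆ᴿ R' → Lift S R ⊆ᴿ Lift S R'
  Lift-mono R⊆R' lift-[]                = lift-[]
  Lift-mono R⊆R' (lift-nf nf lifted)    = lift-nf nf (Lift-mono R⊆R' lifted)
  Lift-mono R⊆R' (lift-step red lifted) = lift-step (R⊆R' red) (Lift-mono R⊆R' lifted)

  IsRewSeq-mono : ∀ {R R'} → R ⊆ᴿ R' → ∀ μ → IsRewSeq S R μ → IsRewSeq S R' μ
  IsRewSeq-mono R⊆R' μ (μ₀-dist , lifted) = μ₀-dist , λ n → Lift-mono R⊆R' (lifted n)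

  AST-wrt-antitone : ∀ {R R'} → R ⊆ᴿ R' → AST-wrt S R' → AST-wrt S R
  AST-wrt-antitone R⊆R' ast μ seq = ast μ (IsRewSeq-mono R⊆R' μ seq)

  PAST-wrt-antitone : ∀ {R R'} → R ⊆ᴿ R' → PAST-wrt S R' → PAST-wrt S R
  PAST-wrt-antitone R⊆R' past μ seq = past μ (IsRewSeq-mono R⊆R' μ seq)

corollary5p3 : (F : Set) (ar : F → ℕ) (V : Set) (S : PTRS {F} {ar} {V}) →
    (fAST-sim S → fAST S) × (iAST-sim S → iAST S) ×
    (fPAST-sim S → fPAST S) × (iPAST-sim S → iPAST S)
corollary5p3 F ar V S =
  AST-wrt-antitone S (Step⊆SimStep S) ,
  AST-wrt-antitone S (IStep⊆ISimStep S) ,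
  PAST-wrt-antitone S (Step⊆SimStep S) ,
  PAST-wrt-antitone S (IStep⊆ISimStep S)
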